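{- Let $G$ be a topological minor of a finite simple graph $H$, with $G$ simple. If $G\in\mathcal{U}$, then $H\in\mathcal{U}$.
   Context: Let $V$ be a finite set of Boolean variables. A clause is a disjunction of literals from $V\cup\neg V\cup\{\top,\bot\}$; a CNF is a conjunction of clauses; it is reduced if unchanged under the rules $x\vee\top=\top$, $x\vee\bot=x$, $x\wedge\top=x$, $x\wedge\bot=\bot$, $x\vee x=x$, $x\wedge x=x$, $\neg\neg x=x$, $x\vee\neg x=\top$. A nontrivial reduced 2-CNF is a reduced CNF other than $\top,\bot$ all of whose clauses have exactly two literals. With $|x|=|\neg x|=x$, its associated multigraph has as vertices the variables occurring in it and one edge $\{|a|,|b|\}$ per clause $(a\vee b)$. The 2-CNF is simple if this multigraph has no multiple edges, and the graph is then denoted $\mathcal{G}(S)$. $\mathcal{U}$ is the family of graphs $\mathcal{G}(S)$ with $S$ an unsatisfiable simple 2-CNF. A graph $G$ is a topological minor of $H$ if some subdivision of $G$ (obtained by repeatedly replacing an edge $(u,v)$ by a new vertex $w$ and edges $(u,w),(w,v)$) is isomorphic to a subgraph of $H$. -}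

module Defs where

open import Data.Nat using (ℕ; suc)
open import Data.Fin using (Fin; zero; suc; _≟_)
open import Data.Bool using (Bool; true; false; _∧_; _∨_; not)
open import Data.Product using (Σ; _×_; _,_; proj₁; proj₂; ∃)
open import Data.Sum using (_⊎_)
open import Data.List using (List; [])
open import Data.List.Relation.Unary.All using (All)
open import Data.List.Relation.Unary.Any using (Any)
open import Data.List.Relation.Unary.AllPairs using (AllPairs)
open import Relation.Nullary using (¬_)
open import Relation.Nullary.Decidable using (⌊_⌋)
open import Relation.Binary.PropositionalEquality using (_≡_; _≢_)
open import Function.Definitions using (Injective)
open import Function.Bundles using (_⇔_)

record Graph : Set where
  constructor mkGraph
  field
    size : ℕ
    adj  : Fin size → Fin size → Bool
open Graph public

IsSimple : Graph → Set
IsSimple G = (∀ u v → adj G u v ≡ adj G v u) × (∀ u → adj G u u ≡ false)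

-- Subdivision of an edge (u,v): new vertex w (= zero), old vertex i ↦ suc i;
-- the edge uv is removed and edges uw, wv are added.

private
  _==_ : ∀ {n} → Fin n → Fin n → Bool
  i == j = ⌊ i ≟ j ⌋

subdivide : (G : Graph) → Fin (size G) → Fin (size G) → Graph
subdivide G u v = mkGraph (suc (size G)) a
  where
  isUV : Fin (size G) → Bool
  isUV j = (j == u) ∨ (j == v)
  pairUV : Fin (size G) → Fin (size G) → Bool
  pairUV i j = ((i == u) ∧ (j == v)) ∨ ((i == v) ∧ (j == u))
  a : Fin (suc (size G)) → Fin (suc (size G)) → Bool
  a zero    zero    = false
  a zero    (suc j) = isUV j
  a (suc i) zero    = isUV i
  a (suc i) (suc j) = adj G i j ∧ not (pairUV i j)

data _⇝_ (G : Graph) : Graph → Set where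
  done : G ⇝ G
  step : ∀ {K} → G ⇝ K → (u v : Fin (size K)) → adj K u v ≡ true →
         G ⇝ subdivide K u v

SubgraphOf : Graph → Graph → Set
SubgraphOf K H =
  Σ (Fin (size K) → Fin (size H)) λ f →
    Injective _≡_ _≡_ f ×
    (∀ a b → adj K a b ≡ true → adj H (f a) (f b) ≡ true)

TopologicalMinor : Graph → Graph → Set
TopologicalMinor G H = Σ Graph λ K → (G ⇝ K) × SubgraphOf K H

-- 2-CNFs over the variable set Fin n.
-- A literal is (polarity , variable): (true , x) is x, (false , x) is ¬x.

Literal : ℕ → Set
Literal n = Bool × Fin n

∣_∣ : ∀ {n} → Literal n → Fin n
∣ l ∣ = proj₂ l

Clause : ℕ → Set
Clause n = Literal n × Literal n

CNF2 : ℕ → Set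
CNF2 n = List (Clause n)

OnPair : ∀ {n} → Fin n → Fin n → Clause n → Set
OnPair u v (a , b) = (∣ a ∣ ≡ u × ∣ b ∣ ≡ v) ⊎ (∣ a ∣ ≡ v × ∣ b ∣ ≡ u)

SameEdge : ∀ {n} → Clause n → Clause n → Set
SameEdge (a , b) c = OnPair ∣ a ∣ ∣ b ∣ c

-- Nontrivial reduced simple 2-CNF: a nonempty conjunction of clauses with
-- exactly two (non-constant) literals; reducedness of a clause (no x ∨ x,
-- no x ∨ ¬x) means its two variables differ; simplicity means no two
-- clauses on the same (unordered) variable pair (this also excludes
-- repeated clauses, i.e. x ∧ x).
IsSimple2CNF : ∀ {n} → CNF2 n → Set
IsSimple2CNF S =
  (S ≢ []) ×
  All (λ c → ∣ proj₁ c ∣ ≢ ∣ proj₂ c ∣) S ×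
  AllPairs (λ c d → ¬ SameEdge c d) S

Assignment : ℕ → Set
Assignment n = Fin n → Bool

evalLit : ∀ {n} → Assignment n → Literal n → Bool
evalLit α (true  , x) = α x
evalLit α (false , x) = not (α x)

SatClause : ∀ {n} → Assignment n → Clause n → Set
SatClause α (a , b) = (evalLit α a ≡ true) ⊎ (evalLit α b ≡ true)

Satisfiable : ∀ {n} → CNF2 n → Set
Satisfiable {n} S = ∃ λ (α : Assignment n) → All (SatClause α) S

Unsatisfiable : ∀ {n} → CNF2 n → Set
Unsatisfiable S = ¬ Satisfiable S

-- {u,v} is an edge of the graph 𝒢(S) (one edge per clause).
EdgeOf : ∀ {n} → CNF2 n → Fin n → Fin n → Set
EdgeOf S u v = Any (OnPair u v) S

-- G ∈ 𝒰 : G is the graph of an unsatisfiable simple 2-CNF whose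
-- variables are the vertices of G.
InU : Graph → Set
InU G = Σ (CNF2 (size G)) λ S →
  IsSimple2CNF S × Unsatisfiable S ×
  (∀ u v → (adj G u v ≡ true) ⇔ EdgeOf S u v)

{-# OPTIONS --safe #-}

-- Both steps of a topological minor preserve 𝒰.  If the clause a ∨ b of a witness S
-- sits on the edge uv, subdividing uv by a new vertex w is witnessed by replacing it
-- with (a ∨ w) ∧ (¬w ∨ b): resolving on w turns any model of the new formula into a
-- model of S.  For a supergraph H, rename the variables of S along the embedding and
-- add a positive clause x ∨ y for every edge xy of H not yet represented; extra
-- clauses keep the formula unsatisfiable, and H being loopless and symmetric keeps
-- it a simple 2-CNF with graph exactly H.

module Submission where

open import Defs

open import Data.Bool using (Bool; true; false; _∧_; _∨_; not)
import Data.Bool.Properties as Bool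
open import Data.Fin using (Fin; zero; suc; _≟_)
open import Data.Fin.Properties using (suc-injective)
open import Data.List using (List; []; _∷_; _++_; map; cartesianProduct; allFin)
open import Data.List.Membership.Propositional using (_∈_; find)
open import Data.List.Membership.Propositional.Properties
  using (∈-∃++; ∈-cartesianProduct⁺; ∈-allFin)
open import Data.List.Relation.Binary.Permutation.Propositional as ↭ using (_↭_; ↭-sym)
open import Data.List.Relation.Binary.Permutation.Propositional.Properties
  using (All-resp-↭; Any-resp-↭; ↭-empty-inv; shift)
open import Data.List.Relation.Unary.All as All using (All; []; _∷_)
import Data.List.Relation.Unary.All.Properties as Allₚ
open import Data.List.Relation.Unary.AllPairs as AllPairs using (AllPairs; []; _∷_)
import Data.List.Relation.Unary.AllPairs.Properties as AllPairsₚ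
open import Data.List.Relation.Unary.Any as Any using (Any; here; there; any?)
open import Data.Nat using (ℕ; suc)
open import Data.Product using (∃; ∃₂; _×_; _,_; proj₁; proj₂)
open import Data.Product.Function.NonDependent.Propositional using (_×-⇔_)
open import Data.Sum using (_⊎_; inj₁; inj₂; [_,_]; swap)
open import Data.Sum.Function.Propositional using (_⊎-⇔_)
open import Function using (_∘_; id)
open import Function.Bundles using (_⇔_; mk⇔; Equivalence)
open import Function.Definitions using (Injective)
open import Function.Properties.Equivalence
  using () renaming (refl to ⇔-refl; sym to ⇔-sym; trans to ⇔-trans)
open import Function.Related.TypeIsomorphisms using (¬-cong-⇔)
open import Relation.Binary.Definitions using (Symmetric; _Respects_)
open import Relation.Binary.PropositionalEquality using (_≡_; _≢_; refl; sym; trans; cong; subst)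
open import Relation.Nullary using (¬_; Dec; yes; no; contradiction)
open import Relation.Nullary.Decidable using (⌊_⌋; _×-dec_; _⊎-dec_)

private
  variable
    m n : ℕ

SamePair : Fin n → Fin n → Fin n → Fin n → Set
SamePair p q r s = (p ≡ r × q ≡ s) ⊎ (p ≡ s × q ≡ r)

SamePair-sym : {p q r s : Fin n} → SamePair p q r s → SamePair r s p q
SamePair-sym (inj₁ (p≡r , q≡s)) = inj₁ (sym p≡r , sym q≡s)
SamePair-sym (inj₂ (p≡s , q≡r)) = inj₂ (sym q≡r , sym p≡s)

SamePair-swapˡ : {p q r s : Fin n} → SamePair p q r s → SamePair q p r s
SamePair-swapˡ (inj₁ (p≡r , q≡s)) = inj₂ (q≡s , p≡r)
SamePair-swapˡ (inj₂ (p≡s , q≡r)) = inj₁ (q≡r , p≡s)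

SamePair-swapʳ : {p q r s : Fin n} → SamePair p q r s → SamePair p q s r
SamePair-swapʳ = swap

SamePair-trans : {p q r s t w : Fin n} → SamePair p q r s → SamePair r s t w → SamePair p q t w
SamePair-trans (inj₁ (refl , refl)) rs~tw = rs~tw
SamePair-trans (inj₂ (refl , refl)) rs~tw = SamePair-swapˡ rs~tw

SamePair-endpoints : {p q r s j : Fin n} → SamePair p q r s → (j ≡ p ⊎ j ≡ q) ⇔ (j ≡ r ⊎ j ≡ s)
SamePair-endpoints (inj₁ (refl , refl)) = ⇔-refl
SamePair-endpoints (inj₂ (refl , refl)) = mk⇔ swap swap

SamePair-injective : {f : Fin m → Fin n} → Injective _≡_ _≡_ f →
  {p q r s : Fin m} → SamePair (f p) (f q) (f r) (f s) → SamePair p q r s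
SamePair-injective f-inj (inj₁ (p≡r , q≡s)) = inj₁ (f-inj p≡r , f-inj q≡s)
SamePair-injective f-inj (inj₂ (p≡s , q≡r)) = inj₂ (f-inj p≡s , f-inj q≡r)

¬SameEdge-sym : Symmetric (λ (c d : Clause n) → ¬ SameEdge c d)
¬SameEdge-sym ¬cd = ¬cd ∘ SamePair-sym

EdgeOf-sym : {S : CNF2 n} {x y : Fin n} → EdgeOf S x y → EdgeOf S y x
EdgeOf-sym = Any.map SamePair-swapʳ

EdgeOf? : (S : CNF2 n) (x y : Fin n) → Dec (EdgeOf S x y)
EdgeOf? S x y =
  any? (λ (a , b) → ((∣ a ∣ ≟ x) ×-dec (∣ b ∣ ≟ y)) ⊎-dec ((∣ a ∣ ≟ y) ×-dec (∣ b ∣ ≟ x))) S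

Reduced : CNF2 n → Set
Reduced = All (λ c → ∣ proj₁ c ∣ ≢ ∣ proj₂ c ∣)

EdgeDistinct : CNF2 n → Set
EdgeDistinct = AllPairs (λ c d → ¬ SameEdge c d)

EdgeDistinct-∷ : {a b : Literal n} {S : CNF2 n} →
  ¬ EdgeOf S ∣ a ∣ ∣ b ∣ → EdgeDistinct S → EdgeDistinct ((a , b) ∷ S)
EdgeDistinct-∷ {S = S} ab∉S distinct = Allₚ.¬Any⇒All¬ S ab∉S ∷ distinct

EdgeOf-tail⇔ : {c : Clause n} {R : CNF2 n} {i j : Fin n} → All (λ d → ¬ SameEdge c d) R →
  EdgeOf R i j ⇔ (EdgeOf (c ∷ R) i j × ¬ OnPair i j c)
EdgeOf-tail⇔ {c = c} {R} {i} {j} c-apart = mk⇔ to from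
  where
  to : EdgeOf R i j → EdgeOf (c ∷ R) i j × ¬ OnPair i j c
  to e = there e , λ c-on-ij →
    Allₚ.All¬⇒¬Any c-apart (Any.map (λ d-on-ij → SamePair-trans d-on-ij (SamePair-sym c-on-ij)) e)
  from : EdgeOf (c ∷ R) i j × ¬ OnPair i j c → EdgeOf R i j
  from (here c-on-ij , c-off-ij) = contradiction c-on-ij c-off-ij
  from (there e , _) = e

AllPairs-resp-↭ : {A : Set} {R : A → A → Set} → Symmetric R → (AllPairs R) Respects _↭_
AllPairs-resp-↭ R-sym ↭.refl ps = ps
AllPairs-resp-↭ R-sym (↭.prep x p) (rx ∷ ps) = All-resp-↭ p rx ∷ AllPairs-resp-↭ R-sym p ps
AllPairs-resp-↭ R-sym (↭.swap x y p) ((rxy ∷ rx) ∷ ry ∷ ps) =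
  (R-sym rxy ∷ All-resp-↭ p ry) ∷ All-resp-↭ p rx ∷ AllPairs-resp-↭ R-sym p ps
AllPairs-resp-↭ R-sym (↭.trans p q) = AllPairs-resp-↭ R-sym q ∘ AllPairs-resp-↭ R-sym p

∈⇒↭-∷ : {A : Set} {x : A} {xs : List A} → x ∈ xs → ∃ λ ys → xs ↭ x ∷ ys
∈⇒↭-∷ x∈xs with ys , zs , refl ← ∈-∃++ x∈xs = ys ++ zs , shift _ ys zs

Witnesses : (G : Graph) → CNF2 (size G) → Set
Witnesses G S = IsSimple2CNF S × Unsatisfiable S × (∀ u v → (adj G u v ≡ true) ⇔ EdgeOf S u v)

Witnesses-resp-↭ : {G : Graph} {S T : CNF2 (size G)} → S ↭ T → Witnesses G S → Witnesses G T
Witnesses-resp-↭ {S = S} S↭T ((S≢[] , reduced , distinct) , unsat , edges) =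
  ( (λ T≡[] → S≢[] (↭-empty-inv (subst (S ↭_) T≡[] S↭T)))
  , All-resp-↭ S↭T reduced
  , AllPairs-resp-↭ (λ {c d} → ¬SameEdge-sym {x = c} {d}) S↭T distinct )
  , (λ (α , sat) → unsat (α , All-resp-↭ (↭-sym S↭T) sat))
  , λ u v → ⇔-trans (edges u v) (mk⇔ (Any-resp-↭ S↭T) (Any-resp-↭ (↭-sym S↭T)))

renameLit : (Fin m → Fin n) → Literal m → Literal n
renameLit f (s , x) = s , f x

renameClause : (Fin m → Fin n) → Clause m → Clause n
renameClause f (a , b) = renameLit f a , renameLit f b

renameCNF : (Fin m → Fin n) → CNF2 m → CNF2 n
renameCNF f = map (renameClause f)

module _ {f : Fin m → Fin n} where

  evalLit-rename : (α : Assignment n) (l : Literal m) → evalLit α (renameLit f l) ≡ evalLit (α ∘ f) l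
  evalLit-rename α (true  , x) = refl
  evalLit-rename α (false , x) = refl

  All-SatClause-rename⁻ : {α : Assignment n} {S : CNF2 m} →
    All (SatClause α) (renameCNF f S) → All (SatClause (α ∘ f)) S
  All-SatClause-rename⁻ {α} = All.map (λ {c} → sat {c}) ∘ Allₚ.map⁻
    where
    sat : {c : Clause m} → SatClause α (renameClause f c) → SatClause (α ∘ f) c
    sat {a , _} (inj₁ a-true) = inj₁ (trans (sym (evalLit-rename α a)) a-true)
    sat {_ , b} (inj₂ b-true) = inj₂ (trans (sym (evalLit-rename α b)) b-true)

  Unsatisfiable-rename : {S : CNF2 m} → Unsatisfiable S → Unsatisfiable (renameCNF f S)
  Unsatisfiable-rename unsat (α , sat) = unsat (α ∘ f , All-SatClause-rename⁻ sat)

  Reduced-rename : Injective _≡_ _≡_ f → {S : CNF2 m} → Reduced S → Reduced (renameCNF f S)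
  Reduced-rename f-inj = Allₚ.map⁺ ∘ All.map (_∘ f-inj)

  EdgeDistinct-rename : Injective _≡_ _≡_ f → {S : CNF2 m} →
    EdgeDistinct S → EdgeDistinct (renameCNF f S)
  EdgeDistinct-rename f-inj = AllPairsₚ.map⁺ ∘ AllPairs.map (_∘ SamePair-injective f-inj)

  IsSimple2CNF-rename : Injective _≡_ _≡_ f → {S : CNF2 m} →
    IsSimple2CNF S → IsSimple2CNF (renameCNF f S)
  IsSimple2CNF-rename f-inj {[]}    (S≢[] , _) = contradiction refl S≢[]
  IsSimple2CNF-rename f-inj {_ ∷ _} (_ , reduced , distinct) =
    (λ ()) , Reduced-rename f-inj reduced , EdgeDistinct-rename f-inj distinct

  EdgeOf-rename⁺ : {S : CNF2 m} {p q : Fin m} → EdgeOf S p q → EdgeOf (renameCNF f S) (f p) (f q)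
  EdgeOf-rename⁺ (here (inj₁ (refl , refl))) = here (inj₁ (refl , refl))
  EdgeOf-rename⁺ (here (inj₂ (refl , refl))) = here (inj₂ (refl , refl))
  EdgeOf-rename⁺ (there e) = there (EdgeOf-rename⁺ e)

  EdgeOf-rename⁻ : {S : CNF2 m} {x y : Fin n} → EdgeOf (renameCNF f S) x y →
    ∃₂ λ p q → EdgeOf S p q × f p ≡ x × f q ≡ y
  EdgeOf-rename⁻ {_ ∷ _} (here (inj₁ (refl , refl))) = _ , _ , here (inj₁ (refl , refl)) , refl , refl
  EdgeOf-rename⁻ {_ ∷ _} (here (inj₂ (refl , refl))) = _ , _ , here (inj₂ (refl , refl)) , refl , refl
  EdgeOf-rename⁻ {_ ∷ _} (there e) with p , q , pq∈S , refl , refl ← EdgeOf-rename⁻ e =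
    p , q , there pq∈S , refl , refl

⌊⌋≡true⇔ : {A : Set} (a? : Dec A) → ⌊ a? ⌋ ≡ true ⇔ A
⌊⌋≡true⇔ (yes a) = mk⇔ (λ _ → a) (λ _ → refl)
⌊⌋≡true⇔ (no ¬a) = mk⇔ (λ ()) (λ a → contradiction a ¬a)

∨≡true⇔ : {x y : Bool} → x ∨ y ≡ true ⇔ (x ≡ true ⊎ y ≡ true)
∨≡true⇔ {true}  = mk⇔ inj₁ (λ _ → refl)
∨≡true⇔ {false} = mk⇔ inj₂ [ (λ ()) , id ]

∧≡true⇔ : {x y : Bool} → x ∧ y ≡ true ⇔ (x ≡ true × y ≡ true)
∧≡true⇔ {true}  = mk⇔ (refl ,_) proj₂
∧≡true⇔ {false} = mk⇔ (λ ()) (λ ())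

not≡true⇔ : {x : Bool} → not x ≡ true ⇔ (¬ x ≡ true)
not≡true⇔ {true}  = mk⇔ (λ ()) (λ ¬true → contradiction refl ¬true)
not≡true⇔ {false} = mk⇔ (λ _ ()) (λ _ → refl)

module _ (K : Graph) (u v : Fin (size K)) where

  subdivide-adj-new : ∀ j → adj (subdivide K u v) zero (suc j) ≡ true ⇔ (j ≡ u ⊎ j ≡ v)
  subdivide-adj-new j = ⇔-trans ∨≡true⇔ (⌊⌋≡true⇔ (j ≟ u) ⊎-⇔ ⌊⌋≡true⇔ (j ≟ v))

  subdivide-adj-old : ∀ i j →
    adj (subdivide K u v) (suc i) (suc j) ≡ true ⇔ (adj K i j ≡ true × ¬ SamePair i j u v)
  subdivide-adj-old i j =
    ⇔-trans ∧≡true⇔ (⇔-refl ×-⇔ ⇔-trans not≡true⇔ (¬-cong-⇔ on-uv))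
    where
    ends : ∀ r s → ⌊ i ≟ r ⌋ ∧ ⌊ j ≟ s ⌋ ≡ true ⇔ (i ≡ r × j ≡ s)
    ends r s = ⇔-trans ∧≡true⇔ (⌊⌋≡true⇔ (i ≟ r) ×-⇔ ⌊⌋≡true⇔ (j ≟ s))
    on-uv : (⌊ i ≟ u ⌋ ∧ ⌊ j ≟ v ⌋ ∨ ⌊ i ≟ v ⌋ ∧ ⌊ j ≟ u ⌋) ≡ true ⇔ SamePair i j u v
    on-uv = ⇔-trans ∨≡true⇔ (ends u v ⊎-⇔ ends v u)

-- As in subdivide, the new variable w is zero and the old ones are shifted by suc.
subdivideCNF : Clause n → CNF2 n → CNF2 (suc n)
subdivideCNF (a , b) R =
  (renameLit suc a , (true , zero)) ∷ ((false , zero) , renameLit suc b) ∷ renameCNF suc R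

module _ {a b : Literal n} {R : CNF2 n} where

  subdivideCNF-unsat : Unsatisfiable ((a , b) ∷ R) → Unsatisfiable (subdivideCNF (a , b) R)
  subdivideCNF-unsat unsat (α , sat₁ ∷ sat₂ ∷ satR) =
    unsat (α ∘ suc , resolve sat₁ sat₂ ∷ All-SatClause-rename⁻ satR)
    where
    resolve : SatClause α (renameLit suc a , (true , zero)) →
      SatClause α ((false , zero) , renameLit suc b) → SatClause (α ∘ suc) (a , b)
    resolve (inj₁ a-true) _ = inj₁ (trans (sym (evalLit-rename α a)) a-true)
    resolve (inj₂ _) (inj₂ b-true) = inj₂ (trans (sym (evalLit-rename α b)) b-true)
    resolve (inj₂ w-true) (inj₁ ¬w-true) with () ← trans (sym (cong not w-true)) ¬w-true

  zero-∉-renameCNF-suc : {T : CNF2 n} {y : Fin (suc n)} → ¬ EdgeOf (renameCNF suc T) zero y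
  zero-∉-renameCNF-suc e with _ , _ , _ , () , _ ← EdgeOf-rename⁻ e

  subdivideCNF-reduced : Reduced ((a , b) ∷ R) → Reduced (subdivideCNF (a , b) R)
  subdivideCNF-reduced (_ ∷ reduced) = (λ ()) ∷ (λ ()) ∷ Reduced-rename suc-injective reduced

  subdivideCNF-distinct : ∣ a ∣ ≢ ∣ b ∣ → EdgeDistinct R → EdgeDistinct (subdivideCNF (a , b) R)
  subdivideCNF-distinct a≢b distinct =
    EdgeDistinct-∷ first-apart
      (EdgeDistinct-∷ (zero-∉-renameCNF-suc {R}) (EdgeDistinct-rename suc-injective distinct))
    where
    first-apart : ¬ EdgeOf (((false , zero) , renameLit suc b) ∷ renameCNF suc R) (suc ∣ a ∣) zero
    first-apart (here (inj₁ (() , _)))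
    first-apart (here (inj₂ (_ , b≡a))) = a≢b (sym (suc-injective b≡a))
    first-apart (there e) = zero-∉-renameCNF-suc (EdgeOf-sym e)

  subdivideCNF-edge-zero : ¬ EdgeOf (subdivideCNF (a , b) R) zero zero
  subdivideCNF-edge-zero (here (inj₁ (() , _)))
  subdivideCNF-edge-zero (here (inj₂ (() , _)))
  subdivideCNF-edge-zero (there (here (inj₁ (_ , ()))))
  subdivideCNF-edge-zero (there (here (inj₂ (_ , ()))))
  subdivideCNF-edge-zero (there (there e)) = zero-∉-renameCNF-suc e

  subdivideCNF-edge-new : ∀ j →
    EdgeOf (subdivideCNF (a , b) R) zero (suc j) ⇔ (j ≡ ∣ a ∣ ⊎ j ≡ ∣ b ∣)
  subdivideCNF-edge-new j = mk⇔ to from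
    where
    to : EdgeOf (subdivideCNF (a , b) R) zero (suc j) → j ≡ ∣ a ∣ ⊎ j ≡ ∣ b ∣
    to (here (inj₁ (() , _)))
    to (here (inj₂ (a≡j , _))) = inj₁ (sym (suc-injective a≡j))
    to (there (here (inj₁ (_ , b≡j)))) = inj₂ (sym (suc-injective b≡j))
    to (there (here (inj₂ (() , _))))
    to (there (there e)) = contradiction e zero-∉-renameCNF-suc
    from : j ≡ ∣ a ∣ ⊎ j ≡ ∣ b ∣ → EdgeOf (subdivideCNF (a , b) R) zero (suc j)
    from (inj₁ refl) = here (inj₂ (refl , refl))
    from (inj₂ refl) = there (here (inj₁ (refl , refl)))

  subdivideCNF-edge-old : ∀ i j → EdgeOf (subdivideCNF (a , b) R) (suc i) (suc j) ⇔ EdgeOf R i j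
  subdivideCNF-edge-old i j = mk⇔ to (there ∘ there ∘ EdgeOf-rename⁺)
    where
    to : EdgeOf (subdivideCNF (a , b) R) (suc i) (suc j) → EdgeOf R i j
    to (here (inj₁ (_ , ())))
    to (here (inj₂ (_ , ())))
    to (there (here (inj₁ (() , _))))
    to (there (here (inj₂ (() , _))))
    to (there (there e)) with _ , _ , e′ , refl , refl ← EdgeOf-rename⁻ e = e′

Witnesses-subdivide : (K : Graph) {u v : Fin (size K)} {a b : Literal (size K)} {R : CNF2 (size K)} →
  OnPair u v (a , b) → Witnesses K ((a , b) ∷ R) → Witnesses (subdivide K u v) (subdivideCNF (a , b) R)
Witnesses-subdivide K {u} {v} {a} {b} {R} c-on-uv
  ((_ , reduced@(a≢b ∷ _) , c-apart ∷ distinct) , unsat , edges) =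
  ((λ ()) , subdivideCNF-reduced reduced , subdivideCNF-distinct a≢b distinct) ,
  subdivideCNF-unsat unsat , edges′
  where
  new : ∀ j → adj (subdivide K u v) zero (suc j) ≡ true ⇔ EdgeOf (subdivideCNF (a , b) R) zero (suc j)
  new j = ⇔-trans (subdivide-adj-new K u v j)
            (⇔-trans (⇔-sym (SamePair-endpoints c-on-uv)) (⇔-sym (subdivideCNF-edge-new j)))

  on-uv⇔on-c : ∀ i j → SamePair i j u v ⇔ OnPair i j (a , b)
  on-uv⇔on-c i j = mk⇔ (λ ij~uv → SamePair-trans c-on-uv (SamePair-sym ij~uv))
                       (λ c-on-ij → SamePair-trans (SamePair-sym c-on-ij) c-on-uv)

  old : ∀ i j →
    adj (subdivide K u v) (suc i) (suc j) ≡ true ⇔ EdgeOf (subdivideCNF (a , b) R) (suc i) (suc j)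
  old i j = ⇔-trans (subdivide-adj-old K u v i j)
              (⇔-trans (edges i j ×-⇔ ¬-cong-⇔ (on-uv⇔on-c i j))
                (⇔-sym (⇔-trans (subdivideCNF-edge-old i j) (EdgeOf-tail⇔ c-apart))))

  edges′ : ∀ p q → adj (subdivide K u v) p q ≡ true ⇔ EdgeOf (subdivideCNF (a , b) R) p q
  edges′ zero    zero    = mk⇔ (λ ()) (λ e → contradiction e subdivideCNF-edge-zero)
  edges′ zero    (suc j) = new j
  edges′ (suc i) zero    = ⇔-trans (new i) (mk⇔ EdgeOf-sym EdgeOf-sym)
  edges′ (suc i) (suc j) = old i j

InU-subdivide : (K : Graph) (u v : Fin (size K)) → adj K u v ≡ true → InU K → InU (subdivide K u v)
InU-subdivide K u v uv∈K (S , witnesses@(_ , _ , edges))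
  with c , c∈S , c-on-uv ← find (Equivalence.to (edges u v) uv∈K)
  with R , S↭cR ← ∈⇒↭-∷ c∈S
  = subdivideCNF c R , Witnesses-subdivide K c-on-uv (Witnesses-resp-↭ S↭cR witnesses)

InU-⇝ : {G K : Graph} → G ⇝ K → InU G → InU K
InU-⇝ done            G∈U = G∈U
InU-⇝ (step G⇝K u v uv∈K) G∈U = InU-subdivide _ u v uv∈K (InU-⇝ G⇝K G∈U)

module EdgeCompletion (H : Graph)
  (H-sym : ∀ x y → adj H x y ≡ adj H y x) (H-loopless : ∀ x → adj H x x ≡ false) where

  EdgesWithin : CNF2 (size H) → Set
  EdgesWithin T = ∀ x y → EdgeOf T x y → adj H x y ≡ true

  record Completion (T : CNF2 (size H)) (L : List (Fin (size H) × Fin (size H))) : Set where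
    field
      added  : CNF2 (size H)
      simple : IsSimple2CNF (added ++ T)
      within : EdgesWithin (added ++ T)
      covers : All (λ (x , y) → adj H x y ≡ true → EdgeOf (added ++ T) x y) L

  module _ {T : CNF2 (size H)} {L : List (Fin (size H) × Fin (size H))} where

    add-edge : {x y : Fin (size H)} (C : Completion T L) →
      adj H x y ≡ true → ¬ EdgeOf (Completion.added C ++ T) x y → Completion T ((x , y) ∷ L)
    add-edge {x} {y} C xy∈H xy∉C = record
      { added  = ((true , x) , (true , y)) ∷ added
      ; simple = (λ ()) , x≢y ∷ proj₁ (proj₂ simple) ,
                 EdgeDistinct-∷ xy∉C (proj₂ (proj₂ simple))
      ; within = within′
      ; covers = (λ _ → here (inj₁ (refl , refl))) ∷ All.map (there ∘_) covers
      }
      where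
      open Completion C
      x≢y : x ≢ y
      x≢y refl with () ← trans (sym xy∈H) (H-loopless x)
      within′ : EdgesWithin (((true , x) , (true , y)) ∷ added ++ T)
      within′ _ _ (here (inj₁ (refl , refl))) = xy∈H
      within′ p q (here (inj₂ (refl , refl))) = trans (H-sym p q) xy∈H
      within′ p q (there e) = within p q e

    cover-by : {x y : Fin (size H)} (C : Completion T L) →
      (adj H x y ≡ true → EdgeOf (Completion.added C ++ T) x y) → Completion T ((x , y) ∷ L)
    cover-by C xy-covered = record { Completion C ; covers = xy-covered ∷ Completion.covers C }

    extend : (x y : Fin (size H)) → Completion T L → Completion T ((x , y) ∷ L)
    extend x y C with EdgeOf? (Completion.added C ++ T) x y | adj H x y Bool.≟ true
    ... | yes xy∈C | _        = cover-by C (λ _ → xy∈C)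
    ... | no _     | no xy∉H  = cover-by C (λ xy∈H → contradiction xy∈H xy∉H)
    ... | no xy∉C  | yes xy∈H = add-edge C xy∈H xy∉C

  complete : {T : CNF2 (size H)} → IsSimple2CNF T → EdgesWithin T → ∀ L → Completion T L
  complete simple within []            =
    record { added = [] ; simple = simple ; within = within ; covers = [] }
  complete simple within ((x , y) ∷ L) = extend x y (complete simple within L)

InU-⊆ : {K H : Graph} → IsSimple H → SubgraphOf K H → InU K → InU H
InU-⊆ {K} {H} (H-sym , H-loopless) (f , f-inj , f-adj) (S , simple , unsat , edges) =
  added ++ T , simple′ , unsat′ , λ x y → mk⇔ (cover x y) (within x y)
  where
  open EdgeCompletion H H-sym H-loopless
  T : CNF2 (size H)
  T = renameCNF f S
  T-within : EdgesWithin T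
  T-within x y e with p , q , pq∈S , refl , refl ← EdgeOf-rename⁻ e =
    f-adj p q (Equivalence.from (edges p q) pq∈S)
  open Completion
    (complete (IsSimple2CNF-rename f-inj simple) T-within (cartesianProduct (allFin _) (allFin _)))
    renaming (simple to simple′)
  unsat′ : Unsatisfiable (added ++ T)
  unsat′ (α , sat) = Unsatisfiable-rename unsat (α , Allₚ.++⁻ʳ added sat)
  cover : ∀ x y → adj H x y ≡ true → EdgeOf (added ++ T) x y
  cover x y = All.lookup covers (∈-cartesianProduct⁺ (∈-allFin x) (∈-allFin y))

corollary6 : (G H : Graph) → IsSimple G → IsSimple H →
    TopologicalMinor G H → InU G → InU H
corollary6 G H _ H-simple (K , G⇝K , K⊆H) G∈U = InU-⊆ H-simple K⊆H (InU-⇝ G⇝K G∈U)
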